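{- For any $n\in\mathbb N$, any string $a\in\{0,1\}^n$ and any functions $g,h:\{0,1\}^n\to\{0,1\}^n$, \[\Pr_{(x,y,z)\sim Q^{\otimes n}}\big[(a_i,g(y)_i,h(z)_i)\text{ wins on }(x_i,y_i,z_i)\text{ for more than }0.99n\text{ values of }i\in[n]\big]\le 3e^{ -10^{ -7}n}.\]
   Context: $Q$ is the uniform distribution on $\{(0,1,1),(1,0,1),(1,1,0)\}\subseteq\{0,1\}^3$, and $Q^{\otimes n}$ draws $n$ i.i.d. samples $(x_i,y_i,z_i)$ from $Q$, forming strings $x,y,z\in\{0,1\}^n$. An answer triple $(a,b,c)\in\{0,1\}^3$ wins on $(x,y,z)\in\{0,1\}^3$ iff $xa+yb+zc=1$. -}

module Defs where

open import Data.Bool using (Bool; true; false; _∧_; _xor_; if_then_else_)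
open import Data.Nat using (ℕ; zero; suc; _+_; _*_; _^_; _<_; _!; NonZero)
open import Data.Nat.Properties using (m*n≢0; m^n≢0; _!≢0)
open import Data.Fin using (Fin; zero; suc)
open import Data.Vec using (Vec; []; _∷_; map; lookup)
open import Data.List using (List; []; _∷_; _++_; length; filter; concatMap)
import Data.List as List
open import Data.Product using (_×_; _,_; proj₁; proj₂)
open import Data.Integer using (+_)
open import Data.Rational using (ℚ; _/_; 0ℚ; _+_)
open import Data.Nat using (_<?_)

-- The support of Q: the three triples (0,1,1), (1,0,1), (1,1,0), indexed by Fin 3.
-- (false = 0, true = 1.)
qTriple : Fin 3 → Bool × Bool × Bool
qTriple zero             = (false , true  , true)
qTriple (suc zero)       = (true  , false , true)
qTriple (suc (suc zero)) = (true  , true  , false)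

wins : Bool × Bool × Bool → Bool × Bool × Bool → Bool
wins (a , b , c) (x , y , z) = ((x ∧ a) xor (y ∧ b)) xor (z ∧ c)

-- All outcomes of Q^{⊗n}: a choice of support element for each coordinate.
-- Q is uniform on its support, so Q^{⊗n} is uniform on these 3^n outcomes.
allSeeds : (n : ℕ) → List (Vec (Fin 3) n)
allSeeds zero    = [] ∷ []
allSeeds (suc n) =
  concatMap (λ s → (zero ∷ s) ∷ (suc zero ∷ s) ∷ (suc (suc zero) ∷ s) ∷ []) (allSeeds n)

xs ys zs : ∀ {n} → Vec (Fin 3) n → Vec Bool n
xs s = map (λ t → proj₁ (qTriple t)) s
ys s = map (λ t → proj₁ (proj₂ (qTriple t))) s
zs s = map (λ t → proj₂ (proj₂ (qTriple t))) s

winCount : ∀ {n} → Vec Bool n → Vec Bool n → Vec Bool n →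
           Vec Bool n → Vec Bool n → Vec Bool n → ℕ
winCount [] [] [] [] [] [] = 0
winCount (a ∷ as) (b ∷ bs) (c ∷ cs) (x ∷ xs′) (y ∷ ys′) (z ∷ zs′) =
  (if wins (a , b , c) (x , y , z) then 1 else 0) Data.Nat.+ winCount as bs cs xs′ ys′ zs′

winsOn : (n : ℕ) → Vec Bool n → (Vec Bool n → Vec Bool n) → (Vec Bool n → Vec Bool n) →
         Vec (Fin 3) n → ℕ
winsOn n a g h s = winCount a (g (ys s)) (h (zs s)) (xs s) (ys s) (zs s)

-- number of the 3^n equally likely outcomes in the event
-- "wins on more than 0.99 n coordinates", i.e. 99·n < 100·(#wins);
-- the probability of the event is goodCount / 3^n
goodCount : (n : ℕ) → Vec Bool n → (Vec Bool n → Vec Bool n) → (Vec Bool n → Vec Bool n) → ℕ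
goodCount n a g h = length (filter (λ s → 99 * n <? 100 * winsOn n a g h s) (allSeeds n))

-- Exponential constant scale: 10^7, so e^{-10^{-7} n} = e^{-n/K}.
K : ℕ
K = 10000000

expTerm : ℕ → ℕ → ℚ
expTerm n k = (+ (n ^ k) / (K ^ k * k !)) {{m*n≢0 (K ^ k) (k !) {{m^n≢0 K k}} {{k !≢0}}}}

-- partial sum  Σ_{k=0}^{m} (n/K)^k / k!  ; these increase to e^{n/K}
expPartial : ℕ → ℕ → ℚ
expPartial n zero    = expTerm n zero
expPartial n (suc m) = expPartial n m Data.Rational.+ expTerm n (suc m)

prob : (n : ℕ) → Vec Bool n → (Vec Bool n → Vec Bool n) → (Vec Bool n → Vec Bool n) → ℚ
prob n a g h = (+ goodCount n a g h / (3 ^ n)) {{m^n≢0 3 n}}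

-- At each coordinate let β and γ record whether g(y) and h(z) agree with a there.  A pointwise
-- certificate 600 + 400·[win] ≤ 2α₁ + α₂ + α₃, for three scores α₁, α₂, α₃ of a coordinate, shows that
-- winning on more than 99 % of the coordinates pushes one of the three score sums over its threshold.
-- Each score depends only on the type of the coordinate and on the answer of one of g and h, which sees a
-- single bit of that type; an exponential-moment bound, proved by peeling off one coordinate at a time,
-- therefore gives each of the three events probability at most (1 − 1/K)ⁿ with K = 10⁷.  Finally every
-- partial sum of e^{n/K} is at most (1 − 1/K)⁻ⁿ, because nⁱ/i! ≤ C(n+i−1, i).

module Submission where

open import Data.Nat using (ℕ)
open import Data.Bool using (Bool; true; false; not; _xor_; if_then_else_)
open import Data.Fin using (Fin; zero; suc)
open import Data.List using (List; []; _∷_; _++_; length; filter; concatMap)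
open import Data.Product using (_,_)
open import Data.Sum using (_⊎_; inj₁; inj₂)
open import Data.Vec using (Vec; []; _∷_; head; tail; map; zipWith)
open import Relation.Binary.PropositionalEquality
open import Relation.Nullary using (yes; no; does)
open import Relation.Unary using (Pred; Decidable)
open import Defs

K-1 : ℕ
K-1 = 9999999

module Fractions where
  open import Data.Nat as ℕ using (suc; NonZero)
  open import Data.Integer as ℤ using (ℤ; +_; +≤+)
  open import Data.Integer.Properties using (pos-*)
  open import Data.Rational using (_/_; _*_; _+_; _≤_; toℚᵘ)
  open import Data.Rational.Properties using (toℚᵘ-cancel-≤; toℚᵘ-homo-*; toℚᵘ-homo-+; toℚᵘ-fromℚᵘ)
  open import Data.Rational.Unnormalised as ℚᵘ using (mkℚᵘ; *≤*)
  import Data.Rational.Unnormalised.Properties as ℚᵘ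

  private
    toℚᵘ-/ : ∀ a b → toℚᵘ (+ a / suc b) ℚᵘ.≃ mkℚᵘ (+ a) b
    toℚᵘ-/ a b = toℚᵘ-fromℚᵘ (mkℚᵘ (+ a) b)

    mkℚᵘ-≤ : ∀ {i j : ℤ} {m n b d} → i ≡ + m → j ≡ + n →
             m ℕ.* suc d ℕ.≤ n ℕ.* suc b → mkℚᵘ i b ℚᵘ.≤ mkℚᵘ j d
    mkℚᵘ-≤ {m = m} {n} {b} {d} refl refl h =
      *≤* (subst₂ ℤ._≤_ (pos-* m (suc d)) (pos-* n (suc b)) (+≤+ h))

    via-ℚᵘ : ∀ {p q u v} → toℚᵘ p ℚᵘ.≃ u → toℚᵘ q ℚᵘ.≃ v → u ℚᵘ.≤ v → p ≤ q
    via-ℚᵘ p≃u q≃v u≤v =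
      toℚᵘ-cancel-≤ (ℚᵘ.≤-respˡ-≃ (ℚᵘ.≃-sym p≃u) (ℚᵘ.≤-respʳ-≃ (ℚᵘ.≃-sym q≃v) u≤v))

  fraction-≤ : ∀ a b c d {{_ : NonZero b}} {{_ : NonZero d}} →
               a ℕ.* d ℕ.≤ c ℕ.* b → + a / b ≤ + c / d
  fraction-≤ a (suc b) c (suc d) h = via-ℚᵘ (toℚᵘ-/ a b) (toℚᵘ-/ c d) (mkℚᵘ-≤ refl refl h)

  fraction-*-≤ : ∀ a b c d e f {{_ : NonZero b}} {{_ : NonZero d}} {{_ : NonZero f}} →
                 a ℕ.* c ℕ.* f ℕ.≤ e ℕ.* (b ℕ.* d) → (+ a / b) * (+ c / d) ≤ + e / f
  fraction-*-≤ a (suc b) c (suc d) e (suc f) h =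
    via-ℚᵘ (ℚᵘ.≃-trans (toℚᵘ-homo-* (+ a / suc b) (+ c / suc d)) (ℚᵘ.*-cong (toℚᵘ-/ a b) (toℚᵘ-/ c d)))
           (toℚᵘ-/ e f) (mkℚᵘ-≤ (sym (pos-* a c)) refl h)

  fraction-+-≤ : ∀ a b c d e f {{_ : NonZero b}} {{_ : NonZero d}} {{_ : NonZero f}} →
                 (a ℕ.* d ℕ.+ c ℕ.* b) ℕ.* f ℕ.≤ e ℕ.* (b ℕ.* d) → (+ a / b) + (+ c / d) ≤ + e / f
  fraction-+-≤ a (suc b) c (suc d) e (suc f) h =
    via-ℚᵘ (ℚᵘ.≃-trans (toℚᵘ-homo-+ (+ a / suc b) (+ c / suc d)) (ℚᵘ.+-cong (toℚᵘ-/ a b) (toℚᵘ-/ c d)))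
           (toℚᵘ-/ e f) (mkℚᵘ-≤ (sym (cong₂ ℤ._+_ (pos-* a (suc d)) (pos-* c (suc b)))) refl h)

module ExponentialSeries where
  open import Data.Nat using (zero; suc; _+_; _*_; _^_; _≤_; _!; NonZero)
  open import Data.Nat.Properties
  open import Data.Nat.Tactic.RingSolver using (solve-∀)
  open import Data.Integer using (+_)
  import Data.Rational as ℚ
  import Data.Rational.Properties as ℚ
  open Fractions

  rising : ℕ → ℕ → ℕ
  rising n zero    = 1
  rising n (suc k) = rising n k * (n + k)

  ^≤rising : ∀ n k → n ^ k ≤ rising n k
  ^≤rising n zero    = ≤-refl
  ^≤rising n (suc k) = begin
    n * n ^ k            ≡⟨ *-comm n (n ^ k) ⟩
    n ^ k * n            ≤⟨ *-mono-≤ (^≤rising n k) (m≤m+n n k) ⟩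
    rising n k * (n + k) ∎
    where open ≤-Reasoning

  rising-suc : ∀ n k → rising n (suc k) ≡ n * rising (suc n) k
  rising-suc n zero    = trans (*-identityˡ (n + 0)) (trans (+-identityʳ n) (sym (*-identityʳ n)))
  rising-suc n (suc k) = begin
    rising n (suc k) * (n + suc k)       ≡⟨ cong (_* (n + suc k)) (rising-suc n k) ⟩
    n * rising (suc n) k * (n + suc k)   ≡⟨ shuffle n (rising (suc n) k) k ⟩
    n * (rising (suc n) k * (suc n + k)) ∎
    where
    open ≡-Reasoning
    shuffle : ∀ n r k → n * r * (n + suc k) ≡ n * (r * (suc n + k))
    shuffle = solve-∀

  rising-pascal : ∀ n k → rising (suc n) (suc k) ≡ rising n (suc k) + suc k * rising (suc n) k
  rising-pascal n k = begin
    rising (suc n) k * (suc n + k)                  ≡⟨ split n (rising (suc n) k) k ⟩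
    n * rising (suc n) k + suc k * rising (suc n) k ≡⟨ cong (_+ suc k * rising (suc n) k) (rising-suc n k) ⟨
    rising n (suc k) + suc k * rising (suc n) k     ∎
    where
    open ≡-Reasoning
    split : ∀ n r k → r * (suc n + k) ≡ n * r + suc k * r
    split = solve-∀

  rising-zero : ∀ k → rising 0 (suc k) ≡ 0
  rising-zero zero    = refl
  rising-zero (suc k) = cong (_* suc k) (rising-zero k)

  -- m! kᵐ Σ_{i ≤ m} rising n i / (i! kⁱ): the m-th partial sum of (1 − 1/k)⁻ⁿ = Σᵢ C(n+i−1, i) k⁻ⁱ,
  -- with its denominator cleared.
  negBinomial : ℕ → ℕ → ℕ → ℕ
  negBinomial k n zero    = 1
  negBinomial k n (suc m) = negBinomial k n m * (suc m * k) + rising n (suc m)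

  negBinomial-pascal : ∀ k n m →
    negBinomial k (suc n) (suc m) ≡ negBinomial k n (suc m) + suc m * negBinomial k (suc n) m
  negBinomial-pascal k n zero    = shuffle n k
    where
    shuffle : ∀ n k → 1 * (1 * k) + 1 * (suc n + 0) ≡ 1 * (1 * k) + 1 * (n + 0) + 1 * 1
    shuffle = solve-∀
  negBinomial-pascal k n (suc m) = begin
    negBinomial k (suc n) (suc m) * (2+m * k) + rising (suc n) (suc (suc m))
      ≡⟨ cong₂ (λ u v → u * (2+m * k) + v) (negBinomial-pascal k n m) (rising-pascal n (suc m)) ⟩
    (A + suc m * B) * (2+m * k) + (rising n (suc (suc m)) + 2+m * rising (suc n) (suc m))
      ≡⟨ shuffle A B (rising n (suc (suc m))) (rising (suc n) (suc m)) m k ⟩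
    (A * (2+m * k) + rising n (suc (suc m))) + 2+m * (B * (suc m * k) + rising (suc n) (suc m)) ∎
    where
    open ≡-Reasoning
    2+m A B : ℕ
    2+m = suc (suc m)
    A = negBinomial k n (suc m)
    B = negBinomial k (suc n) m
    shuffle : ∀ A B r r′ m k → (A + suc m * B) * (suc (suc m) * k) + (r + suc (suc m) * r′)
                             ≡ (A * (suc (suc m) * k) + r) + suc (suc m) * (B * (suc m * k) + r′)
    shuffle = solve-∀

  negBinomial-zero : ∀ k m → negBinomial k 0 m ≡ m ! * k ^ m
  negBinomial-zero k zero    = refl
  negBinomial-zero k (suc m) = begin
    negBinomial k 0 m * (suc m * k) + rising 0 (suc m)
      ≡⟨ cong₂ (λ u v → u * (suc m * k) + v) (negBinomial-zero k m) (rising-zero m) ⟩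
    m ! * k ^ m * (suc m * k) + 0 ≡⟨ shuffle (m !) (k ^ m) m k ⟩
    suc m * m ! * (k * k ^ m)     ∎
    where
    open ≡-Reasoning
    shuffle : ∀ f p m k → f * p * (suc m * k) + 0 ≡ suc m * f * (k * p)
    shuffle = solve-∀

  negBinomial-bound′ : ∀ j n m → negBinomial (suc j) n m * j ^ n ≤ m ! * suc j ^ (m + n)
  negBinomial-bound′ j zero m = ≤-reflexive (begin
    negBinomial (suc j) 0 m * 1 ≡⟨ *-identityʳ _ ⟩
    negBinomial (suc j) 0 m     ≡⟨ negBinomial-zero (suc j) m ⟩
    m ! * suc j ^ m             ≡⟨ cong (λ e → m ! * suc j ^ e) (+-identityʳ m) ⟨
    m ! * suc j ^ (m + 0)       ∎)
    where open ≡-Reasoning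
  negBinomial-bound′ j (suc n) zero = *-monoʳ-≤ 1 (^-monoˡ-≤ (suc n) (n≤1+n j))
  negBinomial-bound′ j (suc n) (suc m) = begin
    negBinomial (suc j) (suc n) (suc m) * (j * j ^ n)
      ≡⟨ cong (_* (j * j ^ n)) (negBinomial-pascal (suc j) n m) ⟩
    (A + suc m * B) * (j * j ^ n)
      ≡⟨ shuffle A B m j (j ^ n) ⟩
    A * j ^ n * j + suc m * (B * (j * j ^ n))
      ≤⟨ +-mono-≤ (*-monoˡ-≤ j (negBinomial-bound′ j n (suc m))) (*-monoʳ-≤ (suc m) (negBinomial-bound′ j (suc n) m)) ⟩
    suc m ! * suc j ^ (suc m + n) * j + suc m * (m ! * suc j ^ (m + suc n))
      ≡⟨ cong (λ e → suc m ! * suc j ^ e * j + suc m * (m ! * suc j ^ (m + suc n))) (+-suc m n) ⟨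
    suc m * m ! * P * j + suc m * (m ! * P)
      ≡⟨ collect m (m !) P j ⟩
    suc m * m ! * (suc j * P) ∎
    where
    open ≤-Reasoning
    A B P : ℕ
    A = negBinomial (suc j) n (suc m)
    B = negBinomial (suc j) (suc n) m
    P = suc j ^ (m + suc n)
    shuffle : ∀ A B m j J → (A + suc m * B) * (j * J) ≡ A * J * j + suc m * (B * (j * J))
    shuffle = solve-∀
    collect : ∀ m f P j → suc m * f * P * j + suc m * (f * P) ≡ suc m * f * (suc j * P)
    collect = solve-∀

  negBinomial-bound : ∀ j n m → negBinomial (suc j) n m * j ^ n ≤ suc j ^ n * (suc j ^ m * m !)
  negBinomial-bound j n m = begin
    negBinomial (suc j) n m * j ^ n ≤⟨ negBinomial-bound′ j n m ⟩
    m ! * suc j ^ (m + n)           ≡⟨ cong (m ! *_) (^-distribˡ-+-* (suc j) m n) ⟩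
    m ! * (suc j ^ m * suc j ^ n)   ≡⟨ shuffle (m !) (suc j ^ m) (suc j ^ n) ⟩
    suc j ^ n * (suc j ^ m * m !)   ∎
    where
    open ≤-Reasoning
    shuffle : ∀ f a b → f * (a * b) ≡ b * (a * f)
    shuffle = solve-∀

  negBinomial-step : ∀ k n m →
    (negBinomial k n m * (k ^ suc m * suc m !) + n ^ suc m * (k ^ m * m !)) * (k ^ suc m * suc m !)
      ≤ negBinomial k n (suc m) * ((k ^ m * m !) * (k ^ suc m * suc m !))
  negBinomial-step k n m = begin
    (S * D′ + n ^ suc m * D) * D′              ≡⟨ cong (λ x → (S * x + n ^ suc m * D) * x) D′≡D*c ⟩
    (S * (D * c) + n ^ suc m * D) * (D * c)    ≡⟨ factor S D c (n ^ suc m) ⟩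
    (S * c + n ^ suc m) * (D * (D * c))        ≤⟨ *-monoˡ-≤ (D * (D * c)) (+-monoʳ-≤ (S * c) (^≤rising n (suc m))) ⟩
    (S * c + rising n (suc m)) * (D * (D * c)) ≡⟨ cong (λ x → (S * c + rising n (suc m)) * (D * x)) D′≡D*c ⟨
    negBinomial k n (suc m) * (D * D′)         ∎
    where
    open ≤-Reasoning
    S D D′ c : ℕ
    S = negBinomial k n m
    D = k ^ m * m !
    D′ = k ^ suc m * suc m !
    c = suc m * k
    D′≡D*c : D′ ≡ D * c
    D′≡D*c = shuffle (k ^ m) (m !) m k
      where
      shuffle : ∀ p f m k → k * p * (suc m * f) ≡ p * f * (suc m * k)
      shuffle = solve-∀
    factor : ∀ S D c x → (S * (D * c) + x * D) * (D * c) ≡ (S * c + x) * (D * (D * c))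
    factor = solve-∀

  -- The arithmetic above is done for a variable k, and instances are passed by hand: conversion checks
  -- and instance search on terms containing the literal K = 10⁷ unfold it in unary.
  K^m*m!-nonZero : ∀ m → NonZero (K ^ m * m !)
  K^m*m!-nonZero m = m*n≢0 (K ^ m) (m !) {{m^n≢0 K m}} {{m !≢0}}

  expPartial-≤-negBinomial : ∀ n m →
    expPartial n m ℚ.≤ (+ negBinomial K n m ℚ./ (K ^ m * m !)) {{K^m*m!-nonZero m}}
  expPartial-≤-negBinomial n zero    = ℚ.≤-refl
  expPartial-≤-negBinomial n (suc m) =
    ℚ.≤-trans (ℚ.+-monoˡ-≤ (expTerm n (suc m)) (expPartial-≤-negBinomial n m))
              (fraction-+-≤ (negBinomial K n m) (K ^ m * m !) (n ^ suc m) (K ^ suc m * suc m !)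
                            (negBinomial K n (suc m)) (K ^ suc m * suc m !)
                            {{K^m*m!-nonZero m}} {{K^m*m!-nonZero (suc m)}} {{K^m*m!-nonZero (suc m)}}
                            (negBinomial-step K n m))

  expPartial-≤ : ∀ n m → expPartial n m ℚ.≤ (+ (K ^ n) ℚ./ (K-1 ^ n)) {{m^n≢0 K-1 n}}
  expPartial-≤ n m = ℚ.≤-trans (expPartial-≤-negBinomial n m)
    (fraction-≤ (negBinomial K n m) (K ^ m * m !) (K ^ n) (K-1 ^ n) {{K^m*m!-nonZero m}} {{m^n≢0 K-1 n}}
                (negBinomial-bound K-1 n m))

module Sums where
  open import Data.Nat using (suc; _+_; _*_; _≤_; z≤n; s≤s)
  open import Level using (0ℓ)
  open import Data.Nat.Properties
  open import Data.Nat.Tactic.RingSolver using (solve-∀)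
  open import Data.List.Properties using (filter-accept)

  private variable
    A B : Set

  sumOf : (A → ℕ) → List A → ℕ
  sumOf f []      = 0
  sumOf f (x ∷ l) = f x + sumOf f l

  sumOf-++ : ∀ (f : A → ℕ) l l′ → sumOf f (l ++ l′) ≡ sumOf f l + sumOf f l′
  sumOf-++ f []      l′ = refl
  sumOf-++ f (x ∷ l) l′ = trans (cong (f x +_) (sumOf-++ f l l′)) (sym (+-assoc (f x) _ _))

  sumOf-concatMap : ∀ (f : B → ℕ) (k : A → List B) l →
                    sumOf f (concatMap k l) ≡ sumOf (λ x → sumOf f (k x)) l
  sumOf-concatMap f k []      = refl
  sumOf-concatMap f k (x ∷ l) =
    trans (sumOf-++ f (k x) (concatMap k l)) (cong (sumOf f (k x) +_) (sumOf-concatMap f k l))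

  sumOf-mono : ∀ {f g : A → ℕ} → (∀ x → f x ≤ g x) → ∀ l → sumOf f l ≤ sumOf g l
  sumOf-mono f≤g []      = z≤n
  sumOf-mono f≤g (x ∷ l) = +-mono-≤ (f≤g x) (sumOf-mono f≤g l)

  sumOf-linear : ∀ a b (f g : A → ℕ) l →
                 sumOf (λ x → a * f x + b * g x) l ≡ a * sumOf f l + b * sumOf g l
  sumOf-linear a b f g []      = sym (cong₂ _+_ (*-zeroʳ a) (*-zeroʳ b))
  sumOf-linear a b f g (x ∷ l) =
    trans (cong (a * f x + b * g x +_) (sumOf-linear a b f g l)) (distrib a b (f x) (g x) _ _)
    where
    distrib : ∀ a b u v U V → a * u + b * v + (a * U + b * V) ≡ a * (u + U) + b * (v + V)
    distrib = solve-∀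

  module _ {P : Pred A 0ℓ} (P? : Decidable P) where

    length-filter-∷ : ∀ {x} l → length (filter P? l) ≤ length (filter P? (x ∷ l))
    length-filter-∷ {x} l with does (P? x)
    ... | true  = n≤1+n _
    ... | false = ≤-refl

    length-filter-accept : ∀ {x} l → P x → length (filter P? (x ∷ l)) ≡ suc (length (filter P? l))
    length-filter-accept l px = cong length (filter-accept P? px)

    length-filter-*-≤-sumOf : ∀ c (W : A → ℕ) → (∀ x → P x → c ≤ W x) →
                              ∀ l → length (filter P? l) * c ≤ sumOf W l
    length-filter-*-≤-sumOf c W c≤W []      = z≤n
    length-filter-*-≤-sumOf c W c≤W (x ∷ l) with P? x
    ... | yes px = +-mono-≤ (c≤W x px) (length-filter-*-≤-sumOf c W c≤W l)
    ... | no  _  = ≤-trans (length-filter-*-≤-sumOf c W c≤W l) (m≤n+m _ (W x))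

  length-filter-∪ : ∀ {P Q R : Pred A 0ℓ} (P? : Decidable P) (Q? : Decidable Q) (R? : Decidable R) →
                    (∀ x → P x → Q x ⊎ R x) →
                    ∀ l → length (filter P? l) ≤ length (filter Q? l) + length (filter R? l)
  length-filter-∪ P? Q? R? P⊆Q∪R []      = z≤n
  length-filter-∪ P? Q? R? P⊆Q∪R (x ∷ l) with ih ← length-filter-∪ P? Q? R? P⊆Q∪R l | P? x
  ... | no  _  = ≤-trans ih (+-mono-≤ (length-filter-∷ Q? l) (length-filter-∷ R? l))
  ... | yes px with P⊆Q∪R x px
  ...   | inj₁ qx = ≤-trans (s≤s ih)
                            (+-mono-≤ (≤-reflexive (sym (length-filter-accept Q? l qx))) (length-filter-∷ R? l))
  ...   | inj₂ rx = begin
    suc (length (filter P? l))                        ≤⟨ s≤s ih ⟩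
    suc (length (filter Q? l) + length (filter R? l)) ≡⟨ +-suc (length (filter Q? l)) (length (filter R? l)) ⟨
    length (filter Q? l) + suc (length (filter R? l)) ≤⟨ +-mono-≤ (length-filter-∷ Q? l)
                                                                  (≤-reflexive (sym (length-filter-accept R? l rx))) ⟩
    length (filter Q? (x ∷ l)) + length (filter R? (x ∷ l)) ∎
    where open ≤-Reasoning

module Chernoff where
  open import Data.Nat using (zero; suc; _+_; _*_; _^_; _∸_; _≤_; _≤?_)
  open import Data.Nat.Properties
  open import Data.Nat.Tactic.RingSolver using (solve-∀)
  open Sums

  private variable
    A B : Set
    n : ℕ

  -- The second vector is taken apart with head and tail rather than by pattern matching, so that
  -- productWith w (t ∷ s) (F y) unfolds for an arbitrary function F.
  sumWith : (A → B → ℕ) → Vec A n → Vec B n → ℕ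
  sumWith f []      bs = 0
  sumWith f (a ∷ s) bs = f a (head bs) + sumWith f s (tail bs)

  productWith : (A → B → ℕ) → Vec A n → Vec B n → ℕ
  productWith f []      bs = 1
  productWith f (a ∷ s) bs = f a (head bs) * productWith f s (tail bs)

  productWith-^ : ∀ p q (α β : A → B → ℕ) (s : Vec A n) bs →
    productWith (λ a b → p ^ α a b * q ^ β a b) s bs ≡ p ^ sumWith α s bs * q ^ sumWith β s bs
  productWith-^ p q α β []      bs = refl
  productWith-^ p q α β (a ∷ s) bs = begin
    p ^ x * q ^ y * productWith _ s (tail bs) ≡⟨ cong (p ^ x * q ^ y *_) (productWith-^ p q α β s (tail bs)) ⟩
    p ^ x * q ^ y * (p ^ X * q ^ Y)         ≡⟨ interchange (p ^ x) (q ^ y) (p ^ X) (q ^ Y) ⟩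
    p ^ x * p ^ X * (q ^ y * q ^ Y)         ≡⟨ cong₂ _*_ (^-distribˡ-+-* p x X) (^-distribˡ-+-* q y Y) ⟨
    p ^ (x + X) * q ^ (y + Y)               ∎
    where
    open ≡-Reasoning
    x y X Y : ℕ
    x = α a (head bs)
    y = β a (head bs)
    X = sumWith α s (tail bs)
    Y = sumWith β s (tail bs)
    interchange : ∀ a b c d → a * b * (c * d) ≡ a * c * (b * d)
    interchange = solve-∀

  sumWith-+-∸ : ∀ c (α : A → B → ℕ) → (∀ a b → α a b ≤ c) → (s : Vec A n) (bs : Vec B n) →
                sumWith α s bs + sumWith (λ a b → c ∸ α a b) s bs ≡ c * n
  sumWith-+-∸ c α α≤c []      bs = sym (*-zeroʳ c)
  sumWith-+-∸ c α α≤c (a ∷ s) bs = begin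
    x + X + (c ∸ x + Y)   ≡⟨ interchange x X (c ∸ x) Y ⟩
    x + (c ∸ x) + (X + Y) ≡⟨ cong₂ _+_ (m+[n∸m]≡n (α≤c a (head bs))) (sumWith-+-∸ c α α≤c s (tail bs)) ⟩
    c + c * _             ≡⟨ *-suc c _ ⟨
    c * suc _             ∎
    where
    open ≡-Reasoning
    x X Y : ℕ
    x = α a (head bs)
    X = sumWith α s (tail bs)
    Y = sumWith (λ a b → c ∸ α a b) s (tail bs)
    interchange : ∀ a b c d → a + b + (c + d) ≡ a + c + (b + d)
    interchange = solve-∀

  ^-distrib-* : ∀ x y n → (x * y) ^ n ≡ x ^ n * y ^ n
  ^-distrib-* x y zero    = refl
  ^-distrib-* x y (suc n) = trans (cong (x * y *_) (^-distrib-* x y n)) (interchange x y (x ^ n) (y ^ n))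
    where
    interchange : ∀ a b c d → a * b * (c * d) ≡ a * c * (b * d)
    interchange = solve-∀

  ^-*-^-≤ : ∀ {p q x y a b} → q ≤ p → x ≤ a → a + b ≡ x + y → p ^ x * q ^ y ≤ p ^ a * q ^ b
  ^-*-^-≤ {p} {q} {x} {y} {a} {b} q≤p x≤a a+b≡x+y = begin
    p ^ x * q ^ y           ≡⟨ cong (λ e → p ^ x * q ^ e) y≡d+b ⟩
    p ^ x * q ^ (d + b)     ≡⟨ cong (p ^ x *_) (^-distribˡ-+-* q d b) ⟩
    p ^ x * (q ^ d * q ^ b) ≤⟨ *-monoʳ-≤ (p ^ x) (*-monoˡ-≤ (q ^ b) (^-monoˡ-≤ d q≤p)) ⟩
    p ^ x * (p ^ d * q ^ b) ≡⟨ *-assoc (p ^ x) (p ^ d) (q ^ b) ⟨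
    p ^ x * p ^ d * q ^ b   ≡⟨ cong (_* q ^ b) (^-distribˡ-+-* p x d) ⟨
    p ^ (x + d) * q ^ b     ≡⟨ cong (λ e → p ^ e * q ^ b) (m+[n∸m]≡n x≤a) ⟩
    p ^ a * q ^ b           ∎
    where
    open ≤-Reasoning
    d : ℕ
    d = a ∸ x
    y≡d+b : y ≡ d + b
    y≡d+b = +-cancelˡ-≡ x y (d + b) (begin-equality
      x + y       ≡⟨ a+b≡x+y ⟨
      a + b       ≡⟨ cong (_+ b) (m+[n∸m]≡n x≤a) ⟨
      x + d + b   ≡⟨ +-assoc x d b ⟩
      x + (d + b) ∎)

  tiltedWeight : ℕ → ℕ → ℕ → (A → B → ℕ) → A → B → ℕ
  tiltedWeight p q c α a b = p ^ α a b * q ^ (c ∸ α a b)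

  tiltedWeight-≥ : ∀ {p q x y} → q ≤ p → (α : A → B → ℕ) → (∀ a b → α a b ≤ x + y) →
                   (s : Vec A n) (bs : Vec B n) → x * n ≤ sumWith α s bs →
                   (p ^ x * q ^ y) ^ n ≤ productWith (tiltedWeight p q (x + y) α) s bs
  tiltedWeight-≥ {A = A} {B = B} {n = n} {p} {q} {x} {y} q≤p α α≤x+y s bs xn≤Σα = begin
    (p ^ x * q ^ y) ^ n                     ≡⟨ ^-distrib-* (p ^ x) (q ^ y) n ⟩
    (p ^ x) ^ n * (q ^ y) ^ n               ≡⟨ cong₂ _*_ (^-*-assoc p x n) (^-*-assoc q y n) ⟩
    p ^ (x * n) * q ^ (y * n)               ≤⟨ ^-*-^-≤ q≤p xn≤Σα total ⟩
    p ^ sumWith α s bs * q ^ sumWith β s bs ≡⟨ productWith-^ p q α β s bs ⟨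
    productWith (tiltedWeight p q (x + y) α) s bs ∎
    where
    open ≤-Reasoning
    β : A → B → ℕ
    β a b = x + y ∸ α a b
    total : sumWith α s bs + sumWith β s bs ≡ x * n + y * n
    total = trans (sumWith-+-∸ (x + y) α α≤x+y s bs) (*-distribʳ-+ n x y)

  outcomes : List (Fin 3)
  outcomes = zero ∷ suc zero ∷ suc (suc zero) ∷ []

  sumOf-allSeeds-suc : ∀ n (f : Vec (Fin 3) (suc n) → ℕ) →
    sumOf f (allSeeds (suc n)) ≡ sumOf (λ s → sumOf (λ t → f (t ∷ s)) outcomes) (allSeeds n)
  sumOf-allSeeds-suc n f = sumOf-concatMap f _ (allSeeds n)

  record RoundBound (obs : Fin 3 → Bool) (w : Fin 3 → Bool → ℕ) (A B : ℕ) : Set where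
    constructor roundBound
    field
      round-≤ : ∀ (u : Bool → Bool) (r : Bool → ℕ) →
                sumOf (λ t → w t (u (obs t)) * r (obs t)) outcomes ≤ A * r true + B * r false

  module _ {obs : Fin 3 → Bool} {w : Fin 3 → Bool → ℕ} {A B : ℕ} (round : RoundBound obs w A B) where

    open RoundBound round

    -- The answers F may depend on all observations; at the first coordinate they depend on the first
    -- observation and on the later ones, which the induction hypothesis absorbs.
    sumOf-productWith-≤ : ∀ n (F : Vec Bool n → Vec Bool n) →
      sumOf (λ s → productWith w s (F (map obs s))) (allSeeds n) ≤ (A + B) ^ n
    sumOf-productWith-≤ zero    F = ≤-refl
    sumOf-productWith-≤ (suc n) F = begin
      sumOf (λ s → productWith w s (F (map obs s))) (allSeeds (suc n))
        ≡⟨ sumOf-allSeeds-suc n _ ⟩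
      sumOf (λ s → sumOf (λ t → w t (u s (obs t)) * r s (obs t)) outcomes) (allSeeds n)
        ≤⟨ sumOf-mono (λ s → round-≤ (u s) (r s)) (allSeeds n) ⟩
      sumOf (λ s → A * r s true + B * r s false) (allSeeds n)
        ≡⟨ sumOf-linear A B (λ s → r s true) (λ s → r s false) (allSeeds n) ⟩
      A * sumOf (λ s → r s true) (allSeeds n) + B * sumOf (λ s → r s false) (allSeeds n)
        ≤⟨ +-mono-≤ (*-monoʳ-≤ A (sumOf-productWith-≤ n (F′ true)))
                    (*-monoʳ-≤ B (sumOf-productWith-≤ n (F′ false))) ⟩
      A * (A + B) ^ n + B * (A + B) ^ n
        ≡⟨ *-distribʳ-+ ((A + B) ^ n) A B ⟨
      (A + B) ^ suc n ∎
      where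
      open ≤-Reasoning
      F′ : Bool → Vec Bool n → Vec Bool n
      F′ b y = tail (F (b ∷ y))
      u : Vec (Fin 3) n → Bool → Bool
      u s b = head (F (b ∷ map obs s))
      r : Vec (Fin 3) n → Bool → ℕ
      r s b = productWith w s (F′ b (map obs s))

  scoreCount : (obs : Fin 3 → Bool) (α : Fin 3 → Bool → ℕ) (x : ℕ) → ∀ n → (Vec Bool n → Vec Bool n) → ℕ
  scoreCount obs α x n F = length (filter (λ s → x * n ≤? sumWith α s (F (map obs s))) (allSeeds n))

  scoreCount-≤ : ∀ p q x y {obs A B} → q ≤ p → (α : Fin 3 → Bool → ℕ) → (∀ t b → α t b ≤ x + y) →
    RoundBound obs (tiltedWeight p q (x + y) α) A B →
    ∀ n (F : Vec Bool n → Vec Bool n) → scoreCount obs α x n F * (p ^ x * q ^ y) ^ n ≤ (A + B) ^ n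
  scoreCount-≤ p q x y {obs} q≤p α α≤x+y round n F =
    ≤-trans (length-filter-*-≤-sumOf (λ s → _ ≤? _) _ _
               (λ s → tiltedWeight-≥ {p = p} {q} {x} {y} q≤p α α≤x+y s (F (map obs s))) (allSeeds n))
            (sumOf-productWith-≤ round n F)

module Game where
  open import Data.Nat using (suc; _+_; _*_; _^_; _≤_; _<_; _≤?_; _<?_; z≤n; NonZero)
  open import Data.Nat.Properties
  open import Data.Nat.Tactic.RingSolver using (solve-∀)
  open import Data.Empty using (⊥-elim)
  open import Data.Product using (proj₁; proj₂)
  open import Relation.Unary.Properties using (_∪?_)
  open Sums
  open Chernoff

  pattern t₁ = zero
  pattern t₂ = suc zero
  pattern t₃ = suc (suc zero)

  yOf zOf : Fin 3 → Bool
  yOf t = proj₁ (proj₂ (qTriple t))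
  zOf t = proj₂ (proj₂ (qTriple t))

  agree : Bool → Bool → Bool
  agree b a = not (b xor a)

  agreement : ∀ {n} → Vec Bool n → Vec Bool n → Vec Bool n
  agreement = zipWith agree

  -- Scores of a coordinate of type t, where β (γ) records whether g(y) (h(z)) agrees with a there.
  -- g sees y = 1 at both t₁ and t₃, so agreeing with a at such a coordinate moves the score away from 400
  -- by +200 or −400 with equal chances; h is in the same position at t₁ and t₂.
  α₁ α₂ α₃ : Fin 3 → Bool → ℕ
  α₁ t₁ _ = 0
  α₁ _  _ = 100
  α₂ t₁ β = if β then 600 else 400
  α₂ t₂ _ = 400
  α₂ t₃ β = if β then 0 else 400
  α₃ t₁ γ = if γ then 600 else 400
  α₃ t₂ γ = if γ then 0 else 400
  α₃ t₃ _ = 400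

  α₁≤100 : ∀ t β → α₁ t β ≤ 100
  α₁≤100 t₁ _ = ≤ᵇ⇒≤ _ _ _
  α₁≤100 t₂ _ = ≤ᵇ⇒≤ _ _ _
  α₁≤100 t₃ _ = ≤ᵇ⇒≤ _ _ _

  α₂≤600 : ∀ t β → α₂ t β ≤ 600
  α₂≤600 t₁ true  = ≤ᵇ⇒≤ _ _ _
  α₂≤600 t₁ false = ≤ᵇ⇒≤ _ _ _
  α₂≤600 t₂ _     = ≤ᵇ⇒≤ _ _ _
  α₂≤600 t₃ true  = ≤ᵇ⇒≤ _ _ _
  α₂≤600 t₃ false = ≤ᵇ⇒≤ _ _ _

  α₃≤600 : ∀ t γ → α₃ t γ ≤ 600
  α₃≤600 t₁ true  = ≤ᵇ⇒≤ _ _ _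
  α₃≤600 t₁ false = ≤ᵇ⇒≤ _ _ _
  α₃≤600 t₂ true  = ≤ᵇ⇒≤ _ _ _
  α₃≤600 t₂ false = ≤ᵇ⇒≤ _ _ _
  α₃≤600 t₃ _     = ≤ᵇ⇒≤ _ _ _

  win-certificate : ∀ t a b c →
    600 + 400 * (if wins (a , b , c) (qTriple t) then 1 else 0)
      ≤ 2 * α₁ t (agree b a) + α₂ t (agree b a) + α₃ t (agree c a)
  win-certificate t₁ false false false = ≤ᵇ⇒≤ _ _ _
  win-certificate t₁ false false true  = ≤ᵇ⇒≤ _ _ _
  win-certificate t₁ false true  false = ≤ᵇ⇒≤ _ _ _
  win-certificate t₁ false true  true  = ≤ᵇ⇒≤ _ _ _
  win-certificate t₁ true  false false = ≤ᵇ⇒≤ _ _ _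
  win-certificate t₁ true  false true  = ≤ᵇ⇒≤ _ _ _
  win-certificate t₁ true  true  false = ≤ᵇ⇒≤ _ _ _
  win-certificate t₁ true  true  true  = ≤ᵇ⇒≤ _ _ _
  win-certificate t₂ false _ false     = ≤ᵇ⇒≤ _ _ _
  win-certificate t₂ false _ true      = ≤ᵇ⇒≤ _ _ _
  win-certificate t₂ true  _ false     = ≤ᵇ⇒≤ _ _ _
  win-certificate t₂ true  _ true      = ≤ᵇ⇒≤ _ _ _
  win-certificate t₃ false false _     = ≤ᵇ⇒≤ _ _ _
  win-certificate t₃ false true  _     = ≤ᵇ⇒≤ _ _ _
  win-certificate t₃ true  false _     = ≤ᵇ⇒≤ _ _ _
  win-certificate t₃ true  true  _     = ≤ᵇ⇒≤ _ _ _

  winCount-certificate : ∀ {n} (s : Vec (Fin 3) n) (a b c : Vec Bool n) →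
    600 * n + 400 * winCount a b c (xs s) (ys s) (zs s)
      ≤ 2 * sumWith α₁ s (agreement b a) + sumWith α₂ s (agreement b a) + sumWith α₃ s (agreement c a)
  winCount-certificate []      []       []       []       = z≤n
  winCount-certificate {suc n} (t ∷ s) (a ∷ as) (b ∷ bs) (c ∷ cs) = begin
    600 * suc n + 400 * (w + W)                 ≡⟨ split-left n w W ⟩
    (600 + 400 * w) + (600 * n + 400 * W)       ≤⟨ +-mono-≤ (win-certificate t a b c) (winCount-certificate s as bs cs) ⟩
    (2 * u₁ + u₂ + u₃) + (2 * U₁ + U₂ + U₃)     ≡⟨ split-right u₁ u₂ u₃ U₁ U₂ U₃ ⟨
    2 * (u₁ + U₁) + (u₂ + U₂) + (u₃ + U₃)       ∎
    where
    open ≤-Reasoning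
    w W u₁ u₂ u₃ U₁ U₂ U₃ : ℕ
    w = if wins (a , b , c) (qTriple t) then 1 else 0
    W = winCount as bs cs (xs s) (ys s) (zs s)
    u₁ = α₁ t (agree b a)
    u₂ = α₂ t (agree b a)
    u₃ = α₃ t (agree c a)
    U₁ = sumWith α₁ s (agreement bs as)
    U₂ = sumWith α₂ s (agreement bs as)
    U₃ = sumWith α₃ s (agreement cs as)
    split-left : ∀ n w W → 600 * suc n + 400 * (w + W) ≡ (600 + 400 * w) + (600 * n + 400 * W)
    split-left = solve-∀
    split-right : ∀ u₁ u₂ u₃ U₁ U₂ U₃ →
      2 * (u₁ + U₁) + (u₂ + U₂) + (u₃ + U₃) ≡ (2 * u₁ + u₂ + u₃) + (2 * U₁ + U₂ + U₃)
    split-right = solve-∀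

  -- 2 · 69 + 429 + 429 = 996 = 600 + 400 · 99/100: below all three thresholds the scores fall short of
  -- what the certificate guarantees once more than 99 % of the coordinates are won.
  some-score-high : ∀ n w a₁ a₂ a₃ → 600 * n + 400 * w ≤ 2 * a₁ + a₂ + a₃ → 99 * n < 100 * w →
                    69 * n ≤ a₁ ⊎ (429 * n ≤ a₂ ⊎ 429 * n ≤ a₃)
  some-score-high n w a₁ a₂ a₃ certificate won with 69 * n ≤? a₁ | 429 * n ≤? a₂ | 429 * n ≤? a₃
  ... | yes e₁ | _      | _      = inj₁ e₁
  ... | no _   | yes e₂ | _      = inj₂ (inj₁ e₂)
  ... | no _   | no _   | yes e₃ = inj₂ (inj₂ e₃)
  ... | no ¬e₁ | no ¬e₂ | no ¬e₃ = ⊥-elim (m+1+n≰m X (begin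
    X + 8                                                       ≡⟨ regroup-left n a₁ a₂ a₃ ⟩
    (600 * n + 4 * suc (99 * n)) + (2 * suc a₁ + suc a₂ + suc a₃)
      ≤⟨ +-mono-≤ (+-monoʳ-≤ (600 * n) (*-monoʳ-≤ 4 won))
                  (+-mono-≤ (+-mono-≤ (*-monoʳ-≤ 2 (≰⇒> ¬e₁)) (≰⇒> ¬e₂)) (≰⇒> ¬e₃)) ⟩
    (600 * n + 4 * (100 * w)) + (2 * (69 * n) + 429 * n + 429 * n)
      ≤⟨ +-monoˡ-≤ _ (≤-trans (≤-reflexive (cong (600 * n +_) (sym (*-assoc 4 100 w)))) certificate) ⟩
    (2 * a₁ + a₂ + a₃) + (2 * (69 * n) + 429 * n + 429 * n)     ≡⟨ regroup-right n a₁ a₂ a₃ ⟩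
    X                                                           ∎))
    where
    open ≤-Reasoning
    X : ℕ
    X = 2 * a₁ + a₂ + a₃ + 996 * n
    regroup-left : ∀ n a₁ a₂ a₃ → 2 * a₁ + a₂ + a₃ + 996 * n + 8
                                ≡ (600 * n + 4 * suc (99 * n)) + (2 * suc a₁ + suc a₂ + suc a₃)
    regroup-left = solve-∀
    regroup-right : ∀ n a₁ a₂ a₃ → (2 * a₁ + a₂ + a₃) + (2 * (69 * n) + 429 * n + 429 * n)
                                 ≡ 2 * a₁ + a₂ + a₃ + 996 * n
    regroup-right = solve-∀

  roundBound-y : ∀ {w A B} → (∀ β → w t₁ β + w t₃ β ≤ A) → (∀ β → w t₂ β ≤ B) → RoundBound yOf w A B
  roundBound-y {w} {A} {B} t₁t₃≤A t₂≤B = roundBound λ u r → begin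
    w t₁ (u true) * r true + (w t₂ (u false) * r false + (w t₃ (u true) * r true + 0))
      ≡⟨ collect (w t₁ (u true)) (w t₂ (u false)) (w t₃ (u true)) (r true) (r false) ⟩
    (w t₁ (u true) + w t₃ (u true)) * r true + w t₂ (u false) * r false
      ≤⟨ +-mono-≤ (*-monoˡ-≤ (r true) (t₁t₃≤A (u true))) (*-monoˡ-≤ (r false) (t₂≤B (u false))) ⟩
    A * r true + B * r false ∎
    where
    open ≤-Reasoning
    collect : ∀ a b c r₁ r₀ → a * r₁ + (b * r₀ + (c * r₁ + 0)) ≡ (a + c) * r₁ + b * r₀
    collect = solve-∀

  roundBound-z : ∀ {w A B} → (∀ γ → w t₁ γ + w t₂ γ ≤ A) → (∀ γ → w t₃ γ ≤ B) → RoundBound zOf w A B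
  roundBound-z {w} {A} {B} t₁t₂≤A t₃≤B = roundBound λ u r → begin
    w t₁ (u true) * r true + (w t₂ (u true) * r true + (w t₃ (u false) * r false + 0))
      ≡⟨ collect (w t₁ (u true)) (w t₂ (u true)) (w t₃ (u false)) (r true) (r false) ⟩
    (w t₁ (u true) + w t₂ (u true)) * r true + w t₃ (u false) * r false
      ≤⟨ +-mono-≤ (*-monoˡ-≤ (r true) (t₁t₂≤A (u true))) (*-monoˡ-≤ (r false) (t₃≤B (u false))) ⟩
    A * r true + B * r false ∎
    where
    open ≤-Reasoning
    collect : ∀ a b c r₁ r₀ → a * r₁ + (b * r₁ + (c * r₀ + 0)) ≡ (a + b) * r₁ + c * r₀
    collect = solve-∀

  rescale : ∀ {E C M L k} n .{{_ : NonZero C}} → E * C ^ n ≤ M ^ n → M * L ≤ k * C → E * L ^ n ≤ k ^ n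
  rescale {E} {C} {M} {L} {k} n EC≤M ML≤kC = *-cancelʳ-≤ (E * L ^ n) (k ^ n) (C ^ n) {{m^n≢0 C n}} (begin
    E * L ^ n * C ^ n   ≡⟨ swap E (L ^ n) (C ^ n) ⟩
    E * C ^ n * L ^ n   ≤⟨ *-monoˡ-≤ (L ^ n) EC≤M ⟩
    M ^ n * L ^ n       ≡⟨ ^-distrib-* M L n ⟨
    (M * L) ^ n         ≤⟨ ^-monoˡ-≤ n ML≤kC ⟩
    (k * C) ^ n         ≡⟨ ^-distrib-* k C n ⟩
    k ^ n * C ^ n       ∎)
    where
    open ≤-Reasoning
    swap : ∀ a b c → a * b * c ≡ a * c * b
    swap = solve-∀

  -- With p/q = 1001/1000, the numerical hypothesis bounds the per-coordinate factor (A + B)/(pˣ qʸ)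
  -- by 3 (1 − 1/K).
  scoreCount-rescaled : ∀ x y {obs A B} (α : Fin 3 → Bool → ℕ) → (∀ t b → α t b ≤ x + y) →
    RoundBound obs (tiltedWeight 1001 1000 (x + y) α) A B →
    (A + B) * K ≤ 3 * K-1 * (1001 ^ x * 1000 ^ y) →
    ∀ n (F : Vec Bool n → Vec Bool n) → scoreCount obs α x n F * K ^ n ≤ (3 * K-1) ^ n
  scoreCount-rescaled x y {obs} α α≤x+y round numeric n F =
    rescale {E = scoreCount obs α x n F} n {{m*n≢0 (1001 ^ x) (1000 ^ y) {{m^n≢0 1001 x}} {{m^n≢0 1000 y}}}}
      (scoreCount-≤ 1001 1000 x y (≤ᵇ⇒≤ _ _ _) α α≤x+y round n F) numeric

  scoreCount₁-≤ : ∀ n (F : Vec Bool n → Vec Bool n) → scoreCount yOf α₁ 69 n F * K ^ n ≤ (3 * K-1) ^ n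
  scoreCount₁-≤ = scoreCount-rescaled 69 31 α₁ α₁≤100
    (roundBound-y {A = 1000 ^ 100 + 1001 ^ 100} {B = 1001 ^ 100} (λ _ → ≤-refl) (λ _ → ≤-refl))
    (≤ᵇ⇒≤ _ _ _)

  scoreCount₂-≤ : ∀ n (F : Vec Bool n → Vec Bool n) → scoreCount yOf α₂ 429 n F * K ^ n ≤ (3 * K-1) ^ n
  scoreCount₂-≤ = scoreCount-rescaled 429 171 α₂ α₂≤600
    (roundBound-y {A = 2 * (1001 ^ 400 * 1000 ^ 200)} {B = 1001 ^ 400 * 1000 ^ 200} t₁t₃ (λ _ → ≤-refl))
    (≤ᵇ⇒≤ _ _ _)
    where
    t₁t₃ : ∀ β → tiltedWeight 1001 1000 600 α₂ t₁ β + tiltedWeight 1001 1000 600 α₂ t₃ β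
                   ≤ 2 * (1001 ^ 400 * 1000 ^ 200)
    t₁t₃ true  = ≤ᵇ⇒≤ _ _ _
    t₁t₃ false = ≤ᵇ⇒≤ _ _ _

  scoreCount₃-≤ : ∀ n (F : Vec Bool n → Vec Bool n) → scoreCount zOf α₃ 429 n F * K ^ n ≤ (3 * K-1) ^ n
  scoreCount₃-≤ = scoreCount-rescaled 429 171 α₃ α₃≤600
    (roundBound-z {A = 2 * (1001 ^ 400 * 1000 ^ 200)} {B = 1001 ^ 400 * 1000 ^ 200} t₁t₂ (λ _ → ≤-refl))
    (≤ᵇ⇒≤ _ _ _)
    where
    t₁t₂ : ∀ γ → tiltedWeight 1001 1000 600 α₃ t₁ γ + tiltedWeight 1001 1000 600 α₃ t₂ γ
                   ≤ 2 * (1001 ^ 400 * 1000 ^ 200)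
    t₁t₂ true  = ≤ᵇ⇒≤ _ _ _
    t₁t₂ false = ≤ᵇ⇒≤ _ _ _

  goodCount-≤ : ∀ n a (g h : Vec Bool n → Vec Bool n) → goodCount n a g h * K ^ n ≤ 3 * (3 ^ n * K-1 ^ n)
  goodCount-≤ n a g h = begin
    goodCount n a g h * K ^ n
      ≤⟨ *-monoˡ-≤ (K ^ n) (≤-trans (length-filter-∪ good? E₁? (E₂? ∪? E₃?) good⇒E (allSeeds n))
                                     (+-monoʳ-≤ c₁ (length-filter-∪ (E₂? ∪? E₃?) E₂? E₃? (λ _ e → e) (allSeeds n)))) ⟩
    (c₁ + (c₂ + c₃)) * K ^ n               ≡⟨ distrib c₁ c₂ c₃ (K ^ n) ⟩
    c₁ * K ^ n + (c₂ * K ^ n + c₃ * K ^ n) ≤⟨ +-mono-≤ (scoreCount₁-≤ n B) (+-mono-≤ (scoreCount₂-≤ n B) (scoreCount₃-≤ n C)) ⟩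
    M + (M + M)                            ≡⟨ triple M ⟩
    3 * M                                  ≡⟨ cong (3 *_) (^-distrib-* 3 K-1 n) ⟩
    3 * (3 ^ n * K-1 ^ n)                  ∎
    where
    open ≤-Reasoning
    M : ℕ
    M = (3 * K-1) ^ n
    B C : Vec Bool n → Vec Bool n
    B y = agreement (g y) a
    C z = agreement (h z) a
    good? : Decidable (λ s → 99 * n < 100 * winsOn n a g h s)
    good? s = 99 * n <? 100 * winsOn n a g h s
    E₁? : Decidable (λ s → 69 * n ≤ sumWith α₁ s (B (map yOf s)))
    E₁? s = 69 * n ≤? sumWith α₁ s (B (map yOf s))
    E₂? : Decidable (λ s → 429 * n ≤ sumWith α₂ s (B (map yOf s)))
    E₂? s = 429 * n ≤? sumWith α₂ s (B (map yOf s))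
    E₃? : Decidable (λ s → 429 * n ≤ sumWith α₃ s (C (map zOf s)))
    E₃? s = 429 * n ≤? sumWith α₃ s (C (map zOf s))
    good⇒E : ∀ s → 99 * n < 100 * winsOn n a g h s →
             69 * n ≤ sumWith α₁ s (B (ys s)) ⊎ (429 * n ≤ sumWith α₂ s (B (ys s)) ⊎ 429 * n ≤ sumWith α₃ s (C (zs s)))
    good⇒E s = some-score-high n (winsOn n a g h s) _ _ _ (winCount-certificate s a (g (ys s)) (h (zs s)))
    c₁ c₂ c₃ : ℕ
    c₁ = scoreCount yOf α₁ 69 n B
    c₂ = scoreCount yOf α₂ 429 n B
    c₃ = scoreCount zOf α₃ 429 n C
    distrib : ∀ a b c k → (a + (b + c)) * k ≡ a * k + (b * k + c * k)
    distrib = solve-∀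
    triple : ∀ m → m + (m + m) ≡ 3 * m
    triple = solve-∀

open import Data.Nat using (_^_; NonZero)
import Data.Nat.Properties as ℕ
open import Data.Integer using (+_)
open import Data.Rational using (_/_; _*_; _≤_)
import Data.Rational.Properties as ℚ

proposition4p10 : (n : ℕ) (a : Vec Bool n) (g h : Vec Bool n → Vec Bool n) (m : ℕ) →
    prob n a g h * expPartial n m ≤ + 3 / 1
proposition4p10 n a g h m = ℚ.≤-trans
  (ℚ.*-monoˡ-≤-nonNeg (prob n a g h) {{ℚ.normalize-nonNeg (goodCount n a g h) (3 ^ n) {{3^n≢0}}}}
                      (ExponentialSeries.expPartial-≤ n m))
  (Fractions.fraction-*-≤ (goodCount n a g h) (3 ^ n) (K ^ n) (K-1 ^ n) 3 1 {{3^n≢0}} {{ℕ.m^n≢0 K-1 n}}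
     (ℕ.≤-trans (ℕ.≤-reflexive (ℕ.*-identityʳ _)) (Game.goodCount-≤ n a g h)))
  where
  3^n≢0 : NonZero (3 ^ n)
  3^n≢0 = ℕ.m^n≢0 3 n
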